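{- Let $\tau^+$ be a set of positions with associated terms that is DN for a logic program $P$. Let $Q\Rightarrow_c^\theta Q_1$ be an SLD-derivation step with $c\in P$, where $Q=\mathbf A,p(t_1,\dots,t_n),\mathbf C$ with selected atom $p(t_1,\dots,t_n)$. Let $Q'=\mathbf A',p(t'_1,\dots,t'_n),\mathbf C'$ be a query that is $\Delta[\tau^+]$-more general than $Q$, where the position of $p(t'_1,\dots,t'_n)$ in $Q'$ is the same as that of $p(t_1,\dots,t_n)$ in $Q$. If there exists an SLD-derivation step $Q'\Rightarrow_c^{\theta'}Q'_1$ whose selected atom is $p(t'_1,\dots,t'_n)$, then $Q'_1$ is $\Delta[\tau^+]$-more general than $Q_1$.
   Context: Fix a first-order language $\mathcal L$; $\Pi$ is its set of relation symbols, each $p$ with unique arity $arity(p)$; $TU_{\mathcal L}$ is the set of all terms; $[1,n]=\{1,\dots,n\}$. A query is a finite sequence of atoms; a logic program is a finite set of definite clauses. SLD-derivation step: given a query $\mathbf A,B,\mathbf C$ and a clause $c$, take a variant $H\leftarrow\mathbf B$ of $c$ (the input clause) variable disjoint from the query with $B,H$ unifiable and mgu $\theta$; then $\mathbf A,B,\mathbf C\Rightarrow_c^\theta(\mathbf A,\mathbf B,\mathbf C)\theta$ with selected atom $B$. A term-condition is a map $TU_{\mathcal L}\to\{\mathtt{true},\mathtt{false}\}$. A filter $\Delta$ assigns to each $p\in\Pi$ a partial function $\Delta(p)$ from $[1,arity(p)]$ to term-conditions. For a substitution $\eta$, an atom $A=p(s_1,\dots,s_n)$ is $\Delta$-more general than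 $B$ for $\eta$ if $B=p(t_1,\dots,t_n)$, $t_i=s_i\eta$ for $i\notin Dom(\Delta(p))$, and $\Delta(p)(i)(s_i)=\mathtt{true}$ for $i\in Dom(\Delta(p))$; a query $A_1,\dots,A_n$ is $\Delta$-more general than $B_1,\dots,B_m$ for $\eta$ if $n=m$ and componentwise for the same $\eta$; "$\Delta$-more general" means for some $\eta$. A set of positions with associated terms $\tau^+$ assigns to each $p$ a partial function $\tau^+(p)$ from $[1,arity(p)]$ to $TU_{\mathcal L}$; write $\langle i\mapsto u\rangle\in\tau^+(p)$ if $i\in Dom(\tau^+(p))$ and $\tau^+(p)(i)=u$. Its associated filter $\Delta[\tau^+]$ maps $p$ to the function with domain $Dom(\tau^+(p))$ sending $i$ to the term-condition $t\mapsto\mathtt{true}$ iff $t$ is an instance of $\tau^+(p)(i)$. $\tau^+$ is DN for a clause $p(s_1,\dots,s_n)\leftarrow\mathbf B$ if: (DN1) for all $i\in Dom(\tau^+(p))$, $j\in[1,n]\setminus\{i\}$: $Var(s_i)\cap Var(s_j)=\emptyset$; (DN2) for all $\langle i\mapsto u_i\rangle\in\tau^+(p)$, $s_i$ is more general than $u_i$; (DN3) for all $i\in Dom(\tau^+(p))$, all atoms $q(t_1,\dots,t_m)$ in $\mathbf B$, all $j\in[1,m]\setminus Dom(\tau^+(q))$: $Var(s_i)\cap Var(t_j)=\emptyset$; (DN4) for all atoms $q(t_1,\dots,t_m)$ in $\mathbf B$ and all $\langle j\mapsto u_j\rangle\in\tau^+(q)$, $t_j$ is an instance of $u_j$. $\tau^+$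 is DN for a program if DN for each of its clauses. -}

module Defs where

open import Data.Nat using (ℕ)
open import Data.Fin using (Fin)
open import Data.Vec using (Vec; []; _∷_; lookup)
open import Data.List using (List; []; _∷_; _++_)
open import Data.List.Membership.Propositional using (_∈_)
open import Data.List.Relation.Binary.Pointwise using (Pointwise)
open import Data.Maybe using (Maybe; just; nothing)
open import Data.Product using (Σ; ∃; _×_; _,_)
open import Data.Empty using (⊥)
open import Relation.Nullary using (¬_)
open import Relation.Binary.PropositionalEquality using (_≡_)

record Language : Set₁ where
  field
    Fun      : Set
    funArity : Fun → ℕ
    Pred     : Set
    arity    : Pred → ℕ

module _ (L : Language) where
  open Language L

  data Term : Set where
    var : ℕ → Term
    fun : (f : Fun) → Vec Term (funArity f) → Term

  Subst : Set
  Subst = ℕ → Term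

  data _occursIn_ (x : ℕ) : Term → Set where
    here  : x occursIn var x
    inFun : ∀ {f ts} (i : Fin (funArity f)) → x occursIn lookup ts i → x occursIn fun f ts

  record Atom : Set where
    constructor atom
    field
      pred : Pred
      args : Vec Term (arity pred)

  Query : Set
  Query = List Atom

  record Clause : Set where
    constructor _←_
    field
      head : Atom
      body : List Atom

  Program : Set
  Program = List Clause

module _ {L : Language} where
  open Language L

  mutual
    _⟨_⟩ : Term L → Subst L → Term L
    var x ⟨ σ ⟩ = σ x
    fun f ts ⟨ σ ⟩ = fun f (substVec ts σ)

    substVec : ∀ {n} → Vec (Term L) n → Subst L → Vec (Term L) n
    substVec [] σ = []
    substVec (t ∷ ts) σ = (t ⟨ σ ⟩) ∷ substVec ts σ

  substAtom : Atom L → Subst L → Atom L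
  substAtom (atom p ts) σ = atom p (substVec ts σ)

  substQuery : Query L → Subst L → Query L
  substQuery [] σ = []
  substQuery (A ∷ As) σ = substAtom A σ ∷ substQuery As σ

  substClause : Clause L → Subst L → Clause L
  substClause (H ← Bs) σ = substAtom H σ ← substQuery Bs σ

  data _occursInAtom_ (x : ℕ) : Atom L → Set where
    inArg : ∀ {p ts} (i : Fin (arity p)) → _occursIn_ L x (lookup ts i) → x occursInAtom atom p ts

  data _occursInQuery_ (x : ℕ) : Query L → Set where
    inAtom : ∀ {A As} (ix : A ∈ As) → x occursInAtom A → x occursInQuery As

  data _occursInClause_ (x : ℕ) : Clause L → Set where
    inHead : ∀ {H Bs} → x occursInAtom H → x occursInClause (H ← Bs)
    inBody : ∀ {H Bs} → x occursInQuery Bs → x occursInClause (H ← Bs)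

  IsInstanceOf : Term L → Term L → Set
  IsInstanceOf t u = ∃ λ (σ : Subst L) → t ≡ (u ⟨ σ ⟩)

  MoreGeneral : Term L → Term L → Set
  MoreGeneral s u = IsInstanceOf u s

  record Variant (c' c : Clause L) : Set where
    field
      π     : ℕ → ℕ
      π⁻¹   : ℕ → ℕ
      left  : ∀ x → π⁻¹ (π x) ≡ x
      right : ∀ x → π (π⁻¹ x) ≡ x
      eq    : c' ≡ substClause c (λ x → var (π x))

  VarDisjoint : Clause L → Query L → Set
  VarDisjoint c Q = ∀ x → x occursInClause c → x occursInQuery Q → ⊥

  record MGU (θ : Subst L) (A B : Atom L) : Set where
    field
      unifies : substAtom A θ ≡ substAtom B θ
      mostGeneral : ∀ (σ : Subst L) → substAtom A σ ≡ substAtom B σ →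
                    ∃ λ (δ : Subst L) → ∀ x → σ x ≡ ((θ x) ⟨ δ ⟩)

  record SLDStep (P : Program L) (As : Query L) (B : Atom L) (Cs : Query L)
                 (c : Clause L) (θ : Subst L) (Q₁ : Query L) : Set where
    field
      c∈P      : c ∈ P
      input    : Clause L
      variant  : Variant input c
      disjoint : VarDisjoint input (As ++ (B ∷ Cs))
      mgu      : MGU θ B (Clause.head input)
      result   : Q₁ ≡ substQuery (As ++ (Clause.body input ++ Cs)) θ

  TermCondition : Set₁
  TermCondition = Term L → Set

  Filter : Set₁
  Filter = (p : Pred) → Fin (arity p) → Maybe TermCondition

  PosCond : Maybe TermCondition → Subst L → Term L → Term L → Set
  PosCond nothing  η s t = t ≡ (s ⟨ η ⟩)
  PosCond (just C) η s t = C s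

  data AtomMoreGeneralFor (Δ : Filter) (η : Subst L) : Atom L → Atom L → Set where
    amg : ∀ {p} {s t : Vec (Term L) (arity p)} →
          (∀ i → PosCond (Δ p i) η (lookup s i) (lookup t i)) →
          AtomMoreGeneralFor Δ η (atom p s) (atom p t)

  QueryMoreGeneralFor : Filter → Subst L → Query L → Query L → Set
  QueryMoreGeneralFor Δ η = Pointwise (AtomMoreGeneralFor Δ η)

  QueryMoreGeneral : Filter → Query L → Query L → Set
  QueryMoreGeneral Δ Q' Q = ∃ λ (η : Subst L) → QueryMoreGeneralFor Δ η Q' Q

  PosTerms : Set
  PosTerms = (p : Pred) → Fin (arity p) → Maybe (Term L)

  InDom : PosTerms → (p : Pred) → Fin (arity p) → Set
  InDom τ p i = ∃ λ u → τ p i ≡ just u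

  NotInDom : PosTerms → (p : Pred) → Fin (arity p) → Set
  NotInDom τ p i = τ p i ≡ nothing

  Δ[_] : PosTerms → Filter
  Δ[ τ ] p i with τ p i
  ... | nothing = nothing
  ... | just u  = just (λ t → IsInstanceOf t u)

  Disjoint : Term L → Term L → Set
  Disjoint s t = ∀ x → _occursIn_ L x s → _occursIn_ L x t → ⊥

  record DNClause (τ : PosTerms) (c : Clause L) : Set where
    field
      dn1 : ∀ (i j : Fin (arity (Atom.pred (Clause.head c)))) →
            InDom τ (Atom.pred (Clause.head c)) i → ¬ (i ≡ j) →
            Disjoint (lookup (Atom.args (Clause.head c)) i)
                     (lookup (Atom.args (Clause.head c)) j)
      dn2 : ∀ (i : Fin (arity (Atom.pred (Clause.head c)))) u →
            τ (Atom.pred (Clause.head c)) i ≡ just u →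
            MoreGeneral (lookup (Atom.args (Clause.head c)) i) u
      dn3 : ∀ (i : Fin (arity (Atom.pred (Clause.head c)))) →
            InDom τ (Atom.pred (Clause.head c)) i →
            ∀ {q : Pred} {ts : Vec (Term L) (arity q)} →
            atom q ts ∈ Clause.body c →
            ∀ (j : Fin (arity q)) → NotInDom τ q j →
            Disjoint (lookup (Atom.args (Clause.head c)) i) (lookup ts j)
      dn4 : ∀ {q : Pred} {ts : Vec (Term L) (arity q)} →
            atom q ts ∈ Clause.body c →
            ∀ (j : Fin (arity q)) u → τ q j ≡ just u →
            IsInstanceOf (lookup ts j) u

  DNProgram : PosTerms → Program L → Set
  DNProgram τ P = ∀ {c} → c ∈ P → DNClause τ c

-- Let η witness that Q' is Δ[τ⁺]-more general than Q, and let the clause be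
-- p(s₁,…,sₙ) ← B, used with renamings ρ and π in the two steps; write κ for
-- the substitution ρθ applied to the clause in the first step.  We build one
-- substitution σ that is ηθ on the variables of Q' and that, on the variables
-- of the renamed clause, is κ except at the head positions in Dom(τ⁺(p)).
-- There the filter makes t'ᵢ an instance of the associated term, which by DN2
-- is an instance of sᵢ, so t'ᵢηθ = sᵢγᵢ for some γᵢ, and σ uses γᵢ; by DN1
-- these choices do not interfere.  Then σ unifies p(t'₁,…,t'ₙ) with the renamed head, so σ = θ'δ for
-- some δ, and δ witnesses the claim: outside the domain of the filter, the
-- atoms of Q'θ' are sent by δ to those of Qθ because σ agrees with ηθ on Q',
-- and the body atoms Bπθ' are sent to Bκ because DN3 keeps their free
-- positions away from the head variables where σ departs from κ; inside the
-- domain the required instances survive instantiation (DN4 for the body).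

module Submission where

open import Defs
open import Data.Nat using (ℕ) renaming (_≟_ to _≟ℕ_)
open import Data.Nat.Properties using (suc-injective)
open import Data.Fin using (zero; suc) renaming (_≟_ to _≟F_)
open import Data.Fin.Properties using (any?)
open import Data.Vec using (Vec; []; _∷_; lookup)
open import Data.Vec.Relation.Binary.Pointwise.Extensional using (ext; Pointwise-≡⇒≡)
open import Data.List using ([]; _∷_; _++_; length)
open import Data.List.Relation.Unary.Any as Any using (here; there)
open import Data.List.Membership.Propositional using (_∈_; find; lose)
open import Data.List.Membership.Propositional.Properties using (∈-++⁺ˡ; ∈-++⁺ʳ)
open import Data.List.Relation.Binary.Pointwise using (Pointwise; []; _∷_; ++⁺)
open import Data.Product using (∃; _×_; _,_; proj₁; proj₂)
open import Data.Empty using (⊥-elim)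
open import Data.Maybe using (Maybe; just; nothing)
open import Function using (case_of_; _∘_)
open import Relation.Nullary using (¬_; Dec; yes; no)
open import Relation.Nullary.Decidable using (_×-dec_; map′)
open import Relation.Binary.PropositionalEquality
open ≡-Reasoning

module _ {L : Language} where
  open Language L

  rename : (ℕ → ℕ) → Subst L
  rename π x = var (π x)

  infixl 5 _⨾_
  _⨾_ : Subst L → Subst L → Subst L
  (σ ⨾ ρ) x = σ x ⟨ ρ ⟩

  lookup-substVec : ∀ {n} (ts : Vec (Term L) n) σ i → lookup (substVec ts σ) i ≡ lookup ts i ⟨ σ ⟩
  lookup-substVec (t ∷ ts) σ zero    = refl
  lookup-substVec (t ∷ ts) σ (suc i) = lookup-substVec ts σ i

  mutual
    ⟨⟩-⨾ : ∀ (t : Term L) σ ρ → (t ⟨ σ ⟩) ⟨ ρ ⟩ ≡ t ⟨ σ ⨾ ρ ⟩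
    ⟨⟩-⨾ (var x)    σ ρ = refl
    ⟨⟩-⨾ (fun f ts) σ ρ = cong (fun f) (substVec-⨾ ts σ ρ)

    substVec-⨾ : ∀ {n} (ts : Vec (Term L) n) σ ρ → substVec (substVec ts σ) ρ ≡ substVec ts (σ ⨾ ρ)
    substVec-⨾ []       σ ρ = refl
    substVec-⨾ (t ∷ ts) σ ρ = cong₂ _∷_ (⟨⟩-⨾ t σ ρ) (substVec-⨾ ts σ ρ)

  mutual
    ⟨⟩-identity : ∀ (t : Term L) → t ⟨ var ⟩ ≡ t
    ⟨⟩-identity (var x)    = refl
    ⟨⟩-identity (fun f ts) = cong (fun f) (substVec-identity ts)

    substVec-identity : ∀ {n} (ts : Vec (Term L) n) → substVec ts var ≡ ts
    substVec-identity []       = refl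
    substVec-identity (t ∷ ts) = cong₂ _∷_ (⟨⟩-identity t) (substVec-identity ts)

  mutual
    ⟨⟩-cong : ∀ (t : Term L) {σ ρ} → (∀ x → _occursIn_ L x t → σ x ≡ ρ x) → t ⟨ σ ⟩ ≡ t ⟨ ρ ⟩
    ⟨⟩-cong (var x)    agree = agree x here
    ⟨⟩-cong (fun f ts) agree = cong (fun f) (substVec-cong ts λ i x o → agree x (inFun i o))

    substVec-cong : ∀ {n} (ts : Vec (Term L) n) {σ ρ} →
                    (∀ i x → _occursIn_ L x (lookup ts i) → σ x ≡ ρ x) → substVec ts σ ≡ substVec ts ρ
    substVec-cong []       agree = refl
    substVec-cong (t ∷ ts) agree = cong₂ _∷_ (⟨⟩-cong t (agree zero)) (substVec-cong ts (λ i → agree (suc i)))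

  substAtom-⨾ : ∀ (A : Atom L) σ ρ → substAtom (substAtom A σ) ρ ≡ substAtom A (σ ⨾ ρ)
  substAtom-⨾ (atom p ts) σ ρ = cong (atom p) (substVec-⨾ ts σ ρ)

  substQuery-⨾ : ∀ (Q : Query L) σ ρ → substQuery (substQuery Q σ) ρ ≡ substQuery Q (σ ⨾ ρ)
  substQuery-⨾ []      σ ρ = refl
  substQuery-⨾ (A ∷ Q) σ ρ = cong₂ _∷_ (substAtom-⨾ A σ ρ) (substQuery-⨾ Q σ ρ)

  substQuery-++ : ∀ (Q R : Query L) σ → substQuery (Q ++ R) σ ≡ substQuery Q σ ++ substQuery R σ
  substQuery-++ []      R σ = refl
  substQuery-++ (A ∷ Q) R σ = cong (substAtom A σ ∷_) (substQuery-++ Q R σ)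

  substQuery-resolvent : ∀ (As Bs Cs : Query L) ρ θ →
    substQuery (As ++ substQuery Bs ρ ++ Cs) θ ≡ substQuery As θ ++ substQuery Bs (ρ ⨾ θ) ++ substQuery Cs θ
  substQuery-resolvent As Bs Cs ρ θ = begin
    substQuery (As ++ substQuery Bs ρ ++ Cs) θ
      ≡⟨ substQuery-++ As _ θ ⟩
    substQuery As θ ++ substQuery (substQuery Bs ρ ++ Cs) θ
      ≡⟨ cong (substQuery As θ ++_) (substQuery-++ (substQuery Bs ρ) Cs θ) ⟩
    substQuery As θ ++ substQuery (substQuery Bs ρ) θ ++ substQuery Cs θ
      ≡⟨ cong (λ Bs′ → substQuery As θ ++ Bs′ ++ substQuery Cs θ) (substQuery-⨾ Bs ρ θ) ⟩
    substQuery As θ ++ substQuery Bs (ρ ⨾ θ) ++ substQuery Cs θ ∎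

  atom-injective : ∀ {p} {us vs : Vec (Term L) (arity p)} → atom p us ≡ atom p vs → us ≡ vs
  atom-injective refl = refl

  substAtom-≡⁻ : ∀ {p} {xs ys : Vec (Term L) (arity p)} {σ ρ} →
                 substAtom (atom p xs) σ ≡ substAtom (atom p ys) ρ → ∀ i → lookup xs i ⟨ σ ⟩ ≡ lookup ys i ⟨ ρ ⟩
  substAtom-≡⁻ {xs = xs} {ys} {σ} {ρ} eq i = begin
    lookup xs i ⟨ σ ⟩          ≡⟨ sym (lookup-substVec xs σ i) ⟩
    lookup (substVec xs σ) i   ≡⟨ cong (λ us → lookup us i) (atom-injective eq) ⟩
    lookup (substVec ys ρ) i   ≡⟨ lookup-substVec ys ρ i ⟩
    lookup ys i ⟨ ρ ⟩          ∎

  substAtom-≡⁺ : ∀ {p} {xs ys : Vec (Term L) (arity p)} {σ ρ} →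
                 (∀ i → lookup xs i ⟨ σ ⟩ ≡ lookup ys i ⟨ ρ ⟩) → substAtom (atom p xs) σ ≡ substAtom (atom p ys) ρ
  substAtom-≡⁺ {p} {xs} {ys} {σ} {ρ} eq = cong (atom p) (Pointwise-≡⇒≡ (ext λ i → begin
    lookup (substVec xs σ) i   ≡⟨ lookup-substVec xs σ i ⟩
    lookup xs i ⟨ σ ⟩          ≡⟨ eq i ⟩
    lookup ys i ⟨ ρ ⟩          ≡⟨ sym (lookup-substVec ys ρ i) ⟩
    lookup (substVec ys ρ) i   ∎))

  IsInstanceOf-⟨⟩ : ∀ {t u : Term L} ρ → IsInstanceOf t u → IsInstanceOf (t ⟨ ρ ⟩) u
  IsInstanceOf-⟨⟩ {u = u} ρ (α , refl) = α ⨾ ρ , ⟨⟩-⨾ u α ρ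

  IsInstanceOf-trans : ∀ {t u v : Term L} → IsInstanceOf t u → IsInstanceOf u v → IsInstanceOf t v
  IsInstanceOf-trans {v = v} (α , refl) (β , refl) = β ⨾ α , ⟨⟩-⨾ v β α

  occursIn-⟨⟩ : ∀ {x y} {t : Term L} σ → _occursIn_ L x t → _occursIn_ L y (σ x) → _occursIn_ L y (t ⟨ σ ⟩)
  occursIn-⟨⟩ σ here o′ = o′
  occursIn-⟨⟩ {y = y} {fun f ts} σ (inFun i o) o′ =
    inFun i (subst (_occursIn_ L y) (sym (lookup-substVec ts σ i)) (occursIn-⟨⟩ σ o o′))

  occursInAtom-substAtom : ∀ {x y} {A : Atom L} σ → x occursInAtom A → _occursIn_ L y (σ x) →
                           y occursInAtom substAtom A σ
  occursInAtom-substAtom {y = y} {atom q ts} σ (inArg i o) o′ =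
    inArg i (subst (_occursIn_ L y) (sym (lookup-substVec ts σ i)) (occursIn-⟨⟩ σ o o′))

  ∈-substQuery : ∀ {A : Atom L} {Q} σ → A ∈ Q → substAtom A σ ∈ substQuery Q σ
  ∈-substQuery σ (here refl) = here refl
  ∈-substQuery σ (there A∈Q) = there (∈-substQuery σ A∈Q)

  occursInClause-substClause : ∀ {x y} {c : Clause L} σ → x occursInClause c → _occursIn_ L y (σ x) →
                               y occursInClause substClause c σ
  occursInClause-substClause σ (inHead o)            o′ = inHead (occursInAtom-substAtom σ o o′)
  occursInClause-substClause σ (inBody (inAtom A∈ o)) o′ =
    inBody (inAtom (∈-substQuery σ A∈) (occursInAtom-substAtom σ o o′))

  occursInQuery-⊆ : ∀ {x} {Q R : Query L} → (∀ {A} → A ∈ Q → A ∈ R) → x occursInQuery Q → x occursInQuery R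
  occursInQuery-⊆ Q⊆R (inAtom A∈Q o) = inAtom (Q⊆R A∈Q) o

  mutual
    occursIn? : ∀ x (t : Term L) → Dec (_occursIn_ L x t)
    occursIn? x (var y) with x ≟ℕ y
    ... | yes refl = yes here
    ... | no x≢y   = no λ { here → x≢y refl }
    occursIn? x (fun f ts) =
      map′ (λ (i , o) → inFun i o) (λ { (inFun i o) → i , o }) (occursInVec? x ts)

    occursInVec? : ∀ x {n} (ts : Vec (Term L) n) → Dec (∃ λ i → _occursIn_ L x (lookup ts i))
    occursInVec? x []       = no λ ()
    occursInVec? x (t ∷ ts) with occursIn? x t | occursInVec? x ts
    ... | yes o | _            = yes (zero , o)
    ... | no _  | yes (i , o)  = yes (suc i , o)
    ... | no ¬o | no ¬os       = no λ { (zero , o) → ¬o o ; (suc i , o) → ¬os (i , o) }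

  occursInAtom? : ∀ x (A : Atom L) → Dec (x occursInAtom A)
  occursInAtom? x (atom p ts) =
    map′ (λ (i , o) → inArg i o) (λ { (inArg i o) → i , o }) (occursInVec? x ts)

  occursInQuery? : ∀ x (Q : Query L) → Dec (x occursInQuery Q)
  occursInQuery? x Q = map′ (λ o → let (_ , A∈Q , oA) = find o in inAtom A∈Q oA)
                            (λ { (inAtom A∈Q oA) → lose A∈Q oA })
                            (Any.any? (occursInAtom? x) Q)

  glue : ∀ (Q : Query L) (c : Clause L) {π : ℕ → ℕ} (π⁻¹ : ℕ → ℕ) → (∀ x → π⁻¹ (π x) ≡ x) →
         VarDisjoint (substClause c (rename π)) Q → (α φ : Subst L) →
         ∃ λ σ → (∀ y → y occursInQuery Q → σ y ≡ α y) × (∀ x → x occursInClause c → σ (π x) ≡ φ x)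
  glue Q c {π} π⁻¹ π⁻¹∘π apart α φ = σ , onQuery , onClause
    where
    σ : Subst L
    σ y with occursInQuery? y Q
    ... | yes _ = α y
    ... | no _  = φ (π⁻¹ y)

    onQuery : ∀ y → y occursInQuery Q → σ y ≡ α y
    onQuery y o with occursInQuery? y Q
    ... | yes _ = refl
    ... | no ¬o = ⊥-elim (¬o o)

    onClause : ∀ x → x occursInClause c → σ (π x) ≡ φ x
    onClause x o with occursInQuery? (π x) Q
    ... | yes o′ = ⊥-elim (apart (π x) (occursInClause-substClause (rename π) o here) o′)
    ... | no _   = cong φ (π⁻¹∘π x)

  Pointwise-++⁻ : ∀ {R : Atom L → Atom L → Set} (ws xs : Query L) {ys zs} → length ws ≡ length xs →
                         Pointwise R (ws ++ ys) (xs ++ zs) → Pointwise R ws xs × Pointwise R ys zs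
  Pointwise-++⁻ []       []       _  rs       = [] , rs
  Pointwise-++⁻ (w ∷ ws) (x ∷ xs) eq (r ∷ rs) =
    let (rws , rys) = Pointwise-++⁻ ws xs (suc-injective eq) rs in r ∷ rws , rys

  module _ (τ : PosTerms {L}) where

    InDom? : ∀ q i → Dec (InDom τ q i)
    InDom? q i with τ q i
    ... | nothing = no λ ()
    ... | just u  = yes (u , refl)

    InDom-irrelevant : ∀ {q i} (d d′ : InDom τ q i) → d ≡ d′
    InDom-irrelevant = just-irrelevant
      where
      just-irrelevant : ∀ {m : Maybe (Term L)} (d d′ : ∃ λ u → m ≡ just u) → d ≡ d′
      just-irrelevant (u , refl) (.u , refl) = refl

    PosCond-Δ-free : ∀ {q i η s t} → τ q i ≡ nothing → PosCond (Δ[ τ ] q i) η s t → t ≡ s ⟨ η ⟩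
    PosCond-Δ-free {q} {i} free h with τ q i
    PosCond-Δ-free refl h | nothing = h

    PosCond-Δ-bound : ∀ {q i η s t u} → τ q i ≡ just u → PosCond (Δ[ τ ] q i) η s t → IsInstanceOf s u
    PosCond-Δ-bound {q} {i} bound h with τ q i
    PosCond-Δ-bound refl h | just u = h

    PosCond-Δ-intro : ∀ q i {η s t} → (τ q i ≡ nothing → t ≡ s ⟨ η ⟩) →
                      (∀ u → τ q i ≡ just u → IsInstanceOf s u) → PosCond (Δ[ τ ] q i) η s t
    PosCond-Δ-intro q i free bound with τ q i
    ... | nothing = free refl
    ... | just u  = bound u refl

    AgreeOnFreePositions : Atom L → Subst L → Subst L → Set
    AgreeOnFreePositions (atom q s) σ ρ =
      ∀ i → τ q i ≡ nothing → ∀ x → _occursIn_ L x (lookup s i) → σ x ≡ ρ x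

    AtomMoreGeneralFor-⟨⟩ : ∀ {η δ ρ′ ρ A′ A} → AtomMoreGeneralFor Δ[ τ ] η A′ A →
                            AgreeOnFreePositions A′ (ρ′ ⨾ δ) (η ⨾ ρ) →
                            AtomMoreGeneralFor Δ[ τ ] δ (substAtom A′ ρ′) (substAtom A ρ)
    AtomMoreGeneralFor-⟨⟩ {η} {δ} {ρ′} {ρ} {atom q s} {atom .q t} (amg s≥t) agree =
      amg λ i → PosCond-Δ-intro q i (free i) (bound i)
      where
      free : ∀ i → τ q i ≡ nothing → lookup (substVec t ρ) i ≡ lookup (substVec s ρ′) i ⟨ δ ⟩
      free i e = begin
        lookup (substVec t ρ) i         ≡⟨ lookup-substVec t ρ i ⟩
        lookup t i ⟨ ρ ⟩                ≡⟨ cong (_⟨ ρ ⟩) (PosCond-Δ-free e (s≥t i)) ⟩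
        (lookup s i ⟨ η ⟩) ⟨ ρ ⟩        ≡⟨ ⟨⟩-⨾ (lookup s i) η ρ ⟩
        lookup s i ⟨ η ⨾ ρ ⟩            ≡⟨ ⟨⟩-cong (lookup s i) (λ x o → sym (agree i e x o)) ⟩
        lookup s i ⟨ ρ′ ⨾ δ ⟩           ≡⟨ sym (⟨⟩-⨾ (lookup s i) ρ′ δ) ⟩
        (lookup s i ⟨ ρ′ ⟩) ⟨ δ ⟩       ≡⟨ cong (_⟨ δ ⟩) (sym (lookup-substVec s ρ′ i)) ⟩
        lookup (substVec s ρ′) i ⟨ δ ⟩  ∎

      bound : ∀ i u → τ q i ≡ just u → IsInstanceOf (lookup (substVec s ρ′) i) u
      bound i u e = subst (λ s′ → IsInstanceOf s′ u) (sym (lookup-substVec s ρ′ i))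
                          (IsInstanceOf-⟨⟩ {u = u} ρ′ (PosCond-Δ-bound e (s≥t i)))

    QueryMoreGeneralFor-⟨⟩ : ∀ {η δ ρ′ ρ Q′ Q} → QueryMoreGeneralFor Δ[ τ ] η Q′ Q →
                             (∀ x → x occursInQuery Q′ → (ρ′ ⨾ δ) x ≡ (η ⨾ ρ) x) →
                             QueryMoreGeneralFor Δ[ τ ] δ (substQuery Q′ ρ′) (substQuery Q ρ)
    QueryMoreGeneralFor-⟨⟩ [] agree = []
    QueryMoreGeneralFor-⟨⟩ {Q′ = atom q s ∷ Q′} (A′≥A ∷ Q′≥Q) agree =
      AtomMoreGeneralFor-⟨⟩ A′≥A (λ i _ x o → agree x (inAtom (here refl) (inArg i o)))
      ∷ QueryMoreGeneralFor-⟨⟩ Q′≥Q (λ x o → agree x (occursInQuery-⊆ there o))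

    AtomMoreGeneralFor-identity : ∀ {q} {ws : Vec (Term L) (arity q)} →
                                  (∀ j u → τ q j ≡ just u → IsInstanceOf (lookup ws j) u) →
                                  AtomMoreGeneralFor Δ[ τ ] var (atom q ws) (atom q ws)
    AtomMoreGeneralFor-identity {q} {ws} bound =
      amg λ j → PosCond-Δ-intro q j (λ _ → sym (⟨⟩-identity (lookup ws j))) (bound j)

    Pointwise-substQuery : ∀ {R : Atom L → Atom L → Set} {ρ′ ρ} (Ws : Query L) →
                           (∀ {W} → W ∈ Ws → R (substAtom W ρ′) (substAtom W ρ)) →
                           Pointwise R (substQuery Ws ρ′) (substQuery Ws ρ)
    Pointwise-substQuery []       r = []
    Pointwise-substQuery (W ∷ Ws) r = r (here refl) ∷ Pointwise-substQuery Ws (λ W∈ → r (there W∈))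

module Resolvent {L : Language} (τ : PosTerms {L}) {p : Language.Pred L}
  {hs ts ts′ : Vec (Term L) (Language.arity L p)} {body : Query L}
  (dn : DNClause τ (atom p hs ← body))
  {η θ ρ : Subst L} (ts′≥ts : ∀ i → PosCond (Δ[ τ ] p i) η (lookup ts′ i) (lookup ts i))
  (unifies : substAtom (atom p ts) θ ≡ substAtom (substAtom (atom p hs) ρ) θ)
  (As′ Cs′ : Query L) {π : ℕ → ℕ} (π⁻¹ : ℕ → ℕ) (π⁻¹∘π : ∀ x → π⁻¹ (π x) ≡ x)
  (apart : VarDisjoint (substClause (atom p hs ← body) (rename π)) (As′ ++ atom p ts′ ∷ Cs′))
  {θ′ : Subst L} (mgu : MGU θ′ (atom p ts′) (substAtom (atom p hs) (rename π)))
  where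

  open DNClause dn

  κ : Subst L
  κ = ρ ⨾ θ

  Q′ : Query L
  Q′ = As′ ++ atom p ts′ ∷ Cs′

  ts-unified : ∀ i → lookup ts i ⟨ θ ⟩ ≡ lookup hs i ⟨ κ ⟩
  ts-unified = substAtom-≡⁻ (trans unifies (substAtom-⨾ (atom p hs) ρ θ))

  headInstance : ∀ i → InDom τ p i → IsInstanceOf (lookup ts′ i ⟨ η ⨾ θ ⟩) (lookup hs i)
  headInstance i (u , e) =
    IsInstanceOf-⟨⟩ {u = lookup hs i} (η ⨾ θ)
      (IsInstanceOf-trans {u = u} {v = lookup hs i} (PosCond-Δ-bound τ e (ts′≥ts i)) (dn2 i u e))

  OccursAtDomPosition : ℕ → Set
  OccursAtDomPosition x = ∃ λ i → InDom τ p i × _occursIn_ L x (lookup hs i)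

  occursAtDomPosition? : ∀ x → Dec (OccursAtDomPosition x)
  occursAtDomPosition? x = any? λ i → InDom? τ p i ×-dec occursIn? x (lookup hs i)

  headSubst : Subst L
  headSubst x with occursAtDomPosition? x
  ... | yes (i , d , _) = proj₁ (headInstance i d) x
  ... | no _            = κ x

  headSubst-dom : ∀ i (d : InDom τ p i) x → _occursIn_ L x (lookup hs i) → headSubst x ≡ proj₁ (headInstance i d) x
  headSubst-dom i d x o with occursAtDomPosition? x
  ... | no ¬at = ⊥-elim (¬at (i , d , o))
  ... | yes (j , d′ , o′) with j ≟F i
  ...   | yes refl = cong (λ d″ → proj₁ (headInstance i d″) x) (InDom-irrelevant τ d′ d)
  ...   | no j≢i   = ⊥-elim (dn1 j i d′ j≢i x o′ o)

  headSubst-free : ∀ x → ¬ OccursAtDomPosition x → headSubst x ≡ κ x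
  headSubst-free x ¬at with occursAtDomPosition? x
  ... | yes at = ⊥-elim (¬at at)
  ... | no _   = refl

  headSubst-unifies : ∀ i → lookup hs i ⟨ headSubst ⟩ ≡ lookup ts′ i ⟨ η ⨾ θ ⟩
  headSubst-unifies i with τ p i in e
  ... | just u = begin
    lookup hs i ⟨ headSubst ⟩  ≡⟨ ⟨⟩-cong (lookup hs i) (headSubst-dom i (u , e)) ⟩
    lookup hs i ⟨ γ ⟩          ≡⟨ sym (proj₂ (headInstance i (u , e))) ⟩
    lookup ts′ i ⟨ η ⨾ θ ⟩     ∎
    where γ = proj₁ (headInstance i (u , e))
  ... | nothing = begin
    lookup hs i ⟨ headSubst ⟩      ≡⟨ ⟨⟩-cong (lookup hs i) (λ x o → headSubst-free x (notAtDom x o)) ⟩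
    lookup hs i ⟨ κ ⟩              ≡⟨ sym (ts-unified i) ⟩
    lookup ts i ⟨ θ ⟩              ≡⟨ cong (_⟨ θ ⟩) (PosCond-Δ-free τ e (ts′≥ts i)) ⟩
    (lookup ts′ i ⟨ η ⟩) ⟨ θ ⟩     ≡⟨ ⟨⟩-⨾ (lookup ts′ i) η θ ⟩
    lookup ts′ i ⟨ η ⨾ θ ⟩         ∎
    where
    notAtDom : ∀ x → _occursIn_ L x (lookup hs i) → ¬ OccursAtDomPosition x
    notAtDom x o (j , (u , e′) , o′) with j ≟F i
    ... | yes refl = case trans (sym e) e′ of λ ()
    ... | no j≢i   = dn1 j i (u , e′) j≢i x o′ o

  σ-spec : ∃ λ σ → (∀ y → y occursInQuery Q′ → σ y ≡ (η ⨾ θ) y) ×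
                   (∀ x → x occursInClause (atom p hs ← body) → σ (π x) ≡ headSubst x)
  σ-spec = glue Q′ (atom p hs ← body) π⁻¹ π⁻¹∘π apart (η ⨾ θ) headSubst

  σ : Subst L
  σ = proj₁ σ-spec

  σ-query : ∀ y → y occursInQuery Q′ → σ y ≡ (η ⨾ θ) y
  σ-query = proj₁ (proj₂ σ-spec)

  σ-clause : ∀ x → x occursInClause (atom p hs ← body) → σ (π x) ≡ headSubst x
  σ-clause = proj₂ (proj₂ σ-spec)

  σ-unifies : substAtom (atom p ts′) σ ≡ substAtom (substAtom (atom p hs) (rename π)) σ
  σ-unifies = trans (substAtom-≡⁺ λ i → begin
      lookup ts′ i ⟨ σ ⟩              ≡⟨ ⟨⟩-cong (lookup ts′ i) (λ x o → σ-query x (inAtom ts′∈Q′ (inArg i o))) ⟩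
      lookup ts′ i ⟨ η ⨾ θ ⟩          ≡⟨ sym (headSubst-unifies i) ⟩
      lookup hs i ⟨ headSubst ⟩       ≡⟨ ⟨⟩-cong (lookup hs i) (λ x o → sym (σ-clause x (inHead (inArg i o)))) ⟩
      lookup hs i ⟨ rename π ⨾ σ ⟩    ∎)
    (sym (substAtom-⨾ (atom p hs) (rename π) σ))
    where ts′∈Q′ = ∈-++⁺ʳ As′ (here refl)

  δ-spec : ∃ λ δ → ∀ x → σ x ≡ θ′ x ⟨ δ ⟩
  δ-spec = MGU.mostGeneral mgu σ σ-unifies

  δ : Subst L
  δ = proj₁ δ-spec

  θ′⨾δ≡σ : ∀ x → (θ′ ⨾ δ) x ≡ σ x
  θ′⨾δ≡σ x = sym (proj₂ δ-spec x)

  θ′⨾δ-query : ∀ x → x occursInQuery Q′ → (θ′ ⨾ δ) x ≡ (η ⨾ θ) x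
  θ′⨾δ-query x o = trans (θ′⨾δ≡σ x) (σ-query x o)

  body≥body : ∀ {W} → W ∈ body → AtomMoreGeneralFor Δ[ τ ] δ (substAtom W (rename π ⨾ θ′)) (substAtom W κ)
  body≥body {atom q ws} W∈ = AtomMoreGeneralFor-⟨⟩ τ (AtomMoreGeneralFor-identity τ (dn4 W∈)) agree
    where
    agree : AgreeOnFreePositions τ (atom q ws) (rename π ⨾ θ′ ⨾ δ) (var ⨾ κ)
    agree j e x o = begin
      θ′ (π x) ⟨ δ ⟩  ≡⟨ θ′⨾δ≡σ (π x) ⟩
      σ (π x)         ≡⟨ σ-clause x (inBody (inAtom W∈ (inArg j o))) ⟩
      headSubst x     ≡⟨ headSubst-free x (λ (i , d , o′) → dn3 i d W∈ j e x o′ o) ⟩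
      κ x             ∎

  resolvent-moreGeneral : ∀ {As Cs} → QueryMoreGeneralFor Δ[ τ ] η As′ As → QueryMoreGeneralFor Δ[ τ ] η Cs′ Cs →
    QueryMoreGeneral Δ[ τ ] (substQuery (As′ ++ substQuery body (rename π) ++ Cs′) θ′)
                            (substQuery (As ++ substQuery body ρ ++ Cs) θ)
  resolvent-moreGeneral {As} {Cs} As′≥As Cs′≥Cs = δ ,
    subst₂ (QueryMoreGeneralFor Δ[ τ ] δ)
      (sym (substQuery-resolvent As′ body Cs′ (rename π) θ′)) (sym (substQuery-resolvent As body Cs ρ θ))
      (++⁺ (QueryMoreGeneralFor-⟨⟩ τ As′≥As (λ x o → θ′⨾δ-query x (occursInQuery-⊆ ∈-++⁺ˡ o)))
      (++⁺ (Pointwise-substQuery τ body body≥body)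
           (QueryMoreGeneralFor-⟨⟩ τ Cs′≥Cs (λ x o → θ′⨾δ-query x (occursInQuery-⊆ (∈-++⁺ʳ As′ ∘ there) o)))))

proposition6 : (L : Language) (τ : PosTerms {L}) (P : Program L) →
    DNProgram τ P →
    (As : Query L) (B : Atom L) (Cs : Query L) (c : Clause L) (θ : Subst L) (Q₁ : Query L) →
    SLDStep P As B Cs c θ Q₁ →
    (As' : Query L) (B' : Atom L) (Cs' : Query L) →
    QueryMoreGeneral Δ[ τ ] (As' ++ (B' ∷ Cs')) (As ++ (B ∷ Cs)) →
    length As' ≡ length As →
    (θ' : Subst L) (Q₁' : Query L) →
    SLDStep P As' B' Cs' c θ' Q₁' →
    QueryMoreGeneral Δ[ τ ] Q₁' Q₁
proposition6 L τ P dnP As (atom p ts) Cs (atom p₀ hs ← body) θ Q₁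
    record { c∈P = c∈P ; variant = record { eq = refl } ; mgu = mgu₁ ; result = refl }
    As′ B′ Cs′ (η , Q′≥Q) length≡ θ′ Q₁′
    record { variant = record { π⁻¹ = π⁻¹ ; left = π⁻¹∘π ; eq = refl } ; disjoint = apart ; mgu = mgu₂ ; result = refl }
  with Pointwise-++⁻ As′ As length≡ Q′≥Q | cong Atom.pred (MGU.unifies mgu₁)
... | As′≥As , amg B′≥B ∷ Cs′≥Cs | refl =
  Resolvent.resolvent-moreGeneral τ (dnP c∈P) B′≥B (MGU.unifies mgu₁) As′ Cs′ π⁻¹ π⁻¹∘π apart mgu₂ As′≥As Cs′≥Cs
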